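{- Let $\mathbb{F}$ be a field of positive characteristic $p$ and $S$ an association scheme on a finite set $X$ such that $p\mid k_i$ for every $R_i\in S\setminus O_\vartheta(S)$. If $S$ is $p$-transitive, then $S$ is the unique strongly normal closed subset of $S$ containing $O_\vartheta(S)$.
   Context: $S=\{R_0,\dots,R_d\}$ is an association scheme on $X$ with diagonal $R_0$, transposes $R_{i^*}$, intersection numbers $p_{ij}^k$, valencies $k_i=p_{ii^*}^0$. For nonempty $U,V\subseteq S$, $UV=\{R_k:\exists R_u\in U,R_v\in V,\ p_{uv}^k>0\}$ ($R_i$ stands for $\{R_i\}$). A nonempty $T\subseteq S$ is closed if $T^*T\subseteq T$ ($T^*=\{R_{i^*}:R_i\in T\}$), strongly normal if also $R_{i^*}TR_i\subseteq T$ for all $i$. $O_\vartheta(S)=\{R_i:k_i=1\}$. $\overline{A_i}$ is the image in $M_X(\mathbb{F})$ of the adjacency matrix of $R_i$, $\mathbb{F}S=\mathrm{span}_{\mathbb{F}}\{\overline{A_i}\}$, $\overline{k_i}$ the image of $k_i$ in $\mathbb{F}$. A trivial submodule of the regular $\mathbb{F}S$-module is $\langle v\rangle_{\mathbb{F}}$ with $0\ne v\in\mathbb{F}S$ and $\overline{A_i}v=\overline{k_i}v$ for all $i$; $S$ is $p$-transitive if there is exactly one such submodule. -}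

module Defs where

open import Level using (Level; _⊔_) renaming (suc to lsuc)
open import Data.Nat as ℕ using (ℕ; zero; suc; _<_)
open import Data.Fin using (Fin; zero; suc)
open import Data.Fin.Properties using (_≟_)
open import Relation.Unary using (Pred; _∈_; _⊆_; Satisfiable)
open import Data.Unit using (⊤)
import Data.Unit
open import Data.Bool using (Bool; true; false; _∧_; if_then_else_)
open import Data.Product using (Σ; ∃; ∃-syntax; Σ-syntax; _×_; _,_)
open import Relation.Nullary using (¬_; Dec; yes; no)
open import Relation.Nullary.Decidable using (⌊_⌋)
open import Relation.Binary.PropositionalEquality using (_≡_)
open import Algebra.Bundles using (CommutativeRing)

record Field (c ℓ : Level) : Set (lsuc (c ⊔ ℓ)) where
  field
    commutativeRing : CommutativeRing c ℓ
  open CommutativeRing commutativeRing public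
  field
    1≉0     : ¬ (1# ≈ 0#)
    inverse : ∀ x → ¬ (x ≈ 0#) → ∃[ y ] (x * y ≈ 1#)

module FieldOps {c ℓ : Level} (F : Field c ℓ) where
  open Field F using (Carrier; _≈_; _+_; _*_; 0#; 1#)

  ℕ→F : ℕ → Carrier
  ℕ→F zero    = 0#
  ℕ→F (suc m) = 1# + ℕ→F m

  ΣF : ∀ {n} → (Fin n → Carrier) → Carrier
  ΣF {zero}  f = 0#
  ΣF {suc n} f = f zero + ΣF (λ i → f (suc i))

  HasCharacteristic : ℕ → Set ℓ
  HasCharacteristic p =
    (0 < p) × (ℕ→F p ≈ 0#) × (∀ m → 0 < m → m < p → ¬ (ℕ→F m ≈ 0#))

  Mat : ℕ → Set c
  Mat n = Fin n → Fin n → Carrier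

  _·M_ : ∀ {n} → Mat n → Mat n → Mat n
  (A ·M B) x y = ΣF (λ z → A x z * B z y)

  _⋆M_ : ∀ {n} → Carrier → Mat n → Mat n
  (a ⋆M A) x y = a * A x y

  _≈M_ : ∀ {n} → Mat n → Mat n → Set ℓ
  A ≈M B = ∀ x y → A x y ≈ B x y

  0M : ∀ {n} → Mat n
  0M x y = 0#

count : ∀ {n} → (Fin n → Bool) → ℕ
count {zero}  f = 0
count {suc n} f = (if f zero then 1 else 0) ℕ.+ count (λ i → f (suc i))

-- Association schemes on X = Fin n with relations R_0,…,R_d indexed by
-- Fin (suc d).  rel x y is the index i with (x,y) ∈ R_i (so the R_i
-- partition X × X).

record AssociationScheme (n d : ℕ) : Set where
  field
    rel      : Fin n → Fin n → Fin (suc d)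
    nonempty : ∀ i → ∃[ x ] ∃[ y ] (rel x y ≡ i)
    diagonal : ∀ x y → (rel x y ≡ zero → x ≡ y) × (x ≡ y → rel x y ≡ zero)
    _*       : Fin (suc d) → Fin (suc d)
    transpose : ∀ x y → rel y x ≡ (rel x y) *
    p        : Fin (suc d) → Fin (suc d) → Fin (suc d) → ℕ
    regular  : ∀ i j k x y → rel x y ≡ k →
               count (λ z → ⌊ rel x z ≟ i ⌋ ∧ ⌊ rel z y ≟ j ⌋) ≡ p i j k

module SchemeNotions {n d : ℕ} (S : AssociationScheme n d) where
  open AssociationScheme S public

  Idx : Set
  Idx = Fin (suc d)

  val : Idx → ℕ
  val i = p i (i *) zero

  SubS : Set₁
  SubS = Pred Idx Level.zero

  Oθ : SubS
  Oθ i = val i ≡ 1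

  All : SubS
  All i = Data.Unit.⊤

  ⟦_⟧ : Idx → SubS
  ⟦ i ⟧ j = j ≡ i

  _·S_ : SubS → SubS → SubS
  (U ·S V) k = ∃[ u ] ∃[ v ] (U u × V v × 0 < p u v k)

  _ᵀ : SubS → SubS
  (T ᵀ) k = ∃[ i ] (T i × k ≡ i *)

  Closed : SubS → Set
  Closed T = Satisfiable T × ((T ᵀ) ·S T) ⊆ T

  StronglyNormalClosed : SubS → Set
  StronglyNormalClosed T =
    Closed T × (∀ i → ((⟦ i * ⟧ ·S T) ·S ⟦ i ⟧) ⊆ T)

  UniqueSNContainingOθ : Set₁
  UniqueSNContainingOθ =
    (StronglyNormalClosed All × Oθ ⊆ All) ×
    (∀ (T : SubS) → StronglyNormalClosed T → Oθ ⊆ T → All ⊆ T)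

  module OverField {c ℓ : Level} (F : Field c ℓ) where
    open Field F using (Carrier; _≈_; _+_; _*_; 0#; 1#)
    open FieldOps F

    Adj : Idx → Mat n
    Adj i x y = if ⌊ rel x y ≟ i ⌋ then 1# else 0#

    InFS : Mat n → Set (c ⊔ ℓ)
    InFS v = Σ[ a ∈ (Idx → Carrier) ] (v ≈M (λ x y → ΣF (λ (i : Idx) → a i * Adj i x y)))

    -- v (nonzero, in 𝔽S) spans a trivial submodule of the regular module
    TrivialGen : Mat n → Set (c ⊔ ℓ)
    TrivialGen v =
      InFS v × ¬ (v ≈M 0M) × (∀ i → (Adj i ·M v) ≈M (ℕ→F (val i) ⋆M v))

    SameSpan : Mat n → Mat n → Set (c ⊔ ℓ)
    SameSpan v w = (Σ[ a ∈ Carrier ] (w ≈M (a ⋆M v))) × (Σ[ b ∈ Carrier ] (v ≈M (b ⋆M w)))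

    -- exactly one trivial submodule
    PTransitive : Set (c ⊔ ℓ)
    PTransitive =
      Σ[ v ∈ Mat n ] (TrivialGen v × (∀ w → TrivialGen w → SameSpan v w))

module Submission where

-- Let U be the closed subset generated by O_ϑ(S) and the thin residue O^ϑ(S) (the relations
-- occurring in some R_{j*}R_j); U lies in every strongly normal closed subset containing O_ϑ(S).
-- Since U ⊇ O^ϑ(S), all R_i-neighbours of a point x lie in one U-coset, so the number of them
-- in the U-coset of y is k_i or 0, and it is k_i·[x ∼_U y] when R_i ∈ U.  As p ∣ k_i whenever
-- R_i ∉ U, the matrix ∑_{R_i ∈ U} A_i spans a trivial submodule, and so does J = ∑_i A_i.
-- By p-transitivity the two are proportional, so ∑_{R_i ∈ U} A_i has no zero entry: U = S.

open import Defs
open import Level using (Level)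
open import Data.Nat using (ℕ)
open import Data.Nat.Divisibility using (_∣_)
open import Relation.Nullary using (¬_)

import Algebra.Properties.Semiring.Mult as SemiringMult
open import Data.Bool.Base using (Bool; true; false; T; _∧_; _∨_; if_then_else_)
open import Data.Bool.Properties using (T-≡; T-∧; T-∨; ∧-identityʳ; ∧-zeroʳ)
open import Data.Empty using (⊥-elim)
open import Data.Fin.Base using (Fin; zero; suc)
open import Data.Fin.Properties using (_≟_; suc-injective; any?; all?; ¬∀⟶∃¬)
open import Data.Nat.Base as ℕ using (zero; suc; _≤_; _<_; z≤n; s≤s)
open import Data.Nat.Divisibility using (divides)
open import Data.Nat.GeneralisedArithmetic using (fold)
import Data.Nat.Properties as ℕₚ
open import Data.Product using (∃; ∃₂; _×_; _,_; proj₁; proj₂)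
open import Data.Sum using (_⊎_; inj₁; inj₂; map; map₂)
open import Data.Unit using (tt)
open import Function.Base using (id; _∘_)
open import Function.Bundles using (Equivalence)
open import Relation.Binary.PropositionalEquality using (_≡_; refl; sym; trans; cong; cong₂; subst)
open import Relation.Nullary using (Dec; yes; no)
open import Relation.Nullary.Decidable using (⌊_⌋; T?; toWitness; fromWitness; _×-dec_; _→-dec_)
open import Relation.Unary using (Decidable; _⊆_)

open Equivalence using (to; from)

_⊆ᵇ_ : ∀ {m} → (Fin m → Bool) → (Fin m → Bool) → Set
P ⊆ᵇ Q = ∀ i → T (P i) → T (Q i)

T-ext : ∀ {a b} → (T a → T b) → (T b → T a) → a ≡ b
T-ext {false} {false} _   _   = refl
T-ext {false} {true}  _   b⇒a = ⊥-elim (b⇒a tt)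
T-ext {true}  {false} a⇒b _   = ⊥-elim (a⇒b tt)
T-ext {true}  {true}  _   _   = refl

indicator : Bool → ℕ
indicator b = if b then 1 else 0

indicator-≤ : ∀ b → indicator b ≤ 1
indicator-≤ false = z≤n
indicator-≤ true  = s≤s z≤n

indicator-mono : ∀ a b → (T a → T b) → indicator a ≤ indicator b
indicator-mono false _     _   = z≤n
indicator-mono true  true  _   = s≤s z≤n
indicator-mono true  false a⇒b = ⊥-elim (a⇒b tt)

indicator-strict : ∀ a b → ¬ (T b → T a) → indicator a < indicator b
indicator-strict true  _     b⇏a = ⊥-elim (b⇏a _)
indicator-strict false true  _   = s≤s z≤n
indicator-strict false false b⇏a = ⊥-elim (b⇏a id)

count-cong : ∀ {m} (f g : Fin m → Bool) → (∀ i → f i ≡ g i) → count f ≡ count g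
count-cong {zero}  f g f≗g = refl
count-cong {suc m} f g f≗g =
  cong₂ ℕ._+_ (cong indicator (f≗g zero)) (count-cong (f ∘ suc) (g ∘ suc) (f≗g ∘ suc))

count-false : ∀ m → count {m} (λ _ → false) ≡ 0
count-false zero    = refl
count-false (suc m) = count-false m

count-≤ : ∀ {m} (f : Fin m → Bool) → count f ≤ m
count-≤ {zero}  f = z≤n
count-≤ {suc m} f = ℕₚ.+-mono-≤ (indicator-≤ (f zero)) (count-≤ (f ∘ suc))

count-mono : ∀ {m} (f g : Fin m → Bool) → f ⊆ᵇ g → count f ≤ count g
count-mono {zero}  f g f⊆g = z≤n
count-mono {suc m} f g f⊆g =
  ℕₚ.+-mono-≤ (indicator-mono (f zero) (g zero) (f⊆g zero))
              (count-mono (f ∘ suc) (g ∘ suc) (f⊆g ∘ suc))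

count-strict : ∀ {m} (f g : Fin m → Bool) → f ⊆ᵇ g →
               ∀ i → ¬ (T (g i) → T (f i)) → count f < count g
count-strict {suc m} f g f⊆g zero g⇏f =
  ℕₚ.+-mono-<-≤ (indicator-strict (f zero) (g zero) g⇏f)
                (count-mono (f ∘ suc) (g ∘ suc) (f⊆g ∘ suc))
count-strict {suc m} f g f⊆g (suc i) g⇏f =
  ℕₚ.+-mono-≤-< (indicator-mono (f zero) (g zero) (f⊆g zero))
                (count-strict (f ∘ suc) (g ∘ suc) (f⊆g ∘ suc) i g⇏f)

count-⊂ : ∀ {m} (f g : Fin m → Bool) → f ⊆ᵇ g → ¬ g ⊆ᵇ f → count f < count g
count-⊂ {m} f g f⊆g g⊈f =
  let i , g⇏f = ¬∀⟶∃¬ m _ (λ i → T? (g i) →-dec T? (f i)) g⊈f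
  in  count-strict f g f⊆g i g⇏f

count-pos : ∀ {m} (f : Fin m → Bool) i → T (f i) → 0 < count f
count-pos {suc m} f zero    fi with f zero
... | true = s≤s z≤n
count-pos {suc m} f (suc i) fi =
  ℕₚ.<-≤-trans (count-pos (f ∘ suc) i fi) (ℕₚ.m≤n+m _ (indicator (f zero)))

count-witness : ∀ {m} (f : Fin m → Bool) → 0 < count f → ∃ λ i → T (f i)
count-witness {suc m} f 0<count with f zero in f₀
... | true  = zero , subst T (sym f₀) tt
... | false = let i , fi = count-witness (f ∘ suc) 0<count in suc i , fi

count-∧-constʳ : ∀ {m} (f g : Fin m → Bool) b → (∀ i → T (f i) → g i ≡ b) →
                 count (λ i → f i ∧ g i) ≡ (if b then count f else 0)
count-∧-constʳ {m} f g b g≡b = trans (count-cong _ _ agree) (count-∧ b)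
  where
  agree : ∀ i → f i ∧ g i ≡ f i ∧ b
  agree i with f i | g≡b i
  ... | false | _      = refl
  ... | true  | g≡b[i] = g≡b[i] tt

  count-∧ : ∀ b → count (λ i → f i ∧ b) ≡ (if b then count f else 0)
  count-∧ true  = count-cong _ _ (∧-identityʳ ∘ f)
  count-∧ false = trans (count-cong _ _ (∧-zeroʳ ∘ f)) (count-false m)

module Saturation {m : ℕ} (close : (Fin m → Bool) → Fin m → Bool)
                  (close-mono : ∀ P Q → P ⊆ᵇ Q → close P ⊆ᵇ close Q)
                  (close-extensive : ∀ P → P ⊆ᵇ close P) where

  Stable : (Fin m → Bool) → Set
  Stable P = close P ⊆ᵇ P

  stable? : ∀ P → Dec (Stable P)
  stable? P = all? (λ i → T? (close P i) →-dec T? (P i))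

  fold-extensive : ∀ P k → P ⊆ᵇ fold P close k
  fold-extensive P zero    i Pi = Pi
  fold-extensive P (suc k) i Pi = close-extensive _ i (fold-extensive P k i Pi)

  fold-stable-or-grows : ∀ P k → Stable (fold P close k) ⊎ k ≤ count (fold P close k)
  fold-stable-or-grows P zero = inj₂ z≤n
  fold-stable-or-grows P (suc k) with stable? (fold P close k) | fold-stable-or-grows P k
  ... | yes stable   | _              = inj₁ (close-mono _ _ stable)
  ... | no  unstable | inj₁ stable    = ⊥-elim (unstable stable)
  ... | no  unstable | inj₂ k≤count   =
    inj₂ (ℕₚ.≤-<-trans k≤count (count-⊂ _ _ (close-extensive _) unstable))

  fold-stable : ∀ P → Stable (fold P close (suc m))
  fold-stable P with fold-stable-or-grows P (suc m)
  ... | inj₁ stable  = stable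
  ... | inj₂ m<count = ⊥-elim (ℕₚ.<⇒≱ m<count (count-≤ _))

module SchemeFacts {n d : ℕ} (S : AssociationScheme n d) where
  open SchemeNotions S

  intersection-pos : ∀ {x z y u v k} →
                     rel x z ≡ u → rel z y ≡ v → rel x y ≡ k → 0 < p u v k
  intersection-pos {x} {z} {y} refl refl refl =
    subst (0 <_) (regular _ _ _ x y refl) (count-pos _ z z-between)
    where
    z-between : T (⌊ rel x z ≟ rel x z ⌋ ∧ ⌊ rel z y ≟ rel z y ⌋)
    z-between = from (T-∧ {⌊ rel x z ≟ rel x z ⌋}) (fromWitness refl , fromWitness refl)

  rel-refl : ∀ x → rel x x ≡ zero
  rel-refl x = proj₂ (diagonal x x) refl

  rel-transpose : ∀ {x y i} → rel x y ≡ i → rel y x ≡ i *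
  rel-transpose {x} {y} refl = transpose x y

  zero∈i*·i : ∀ i → 0 < p (i *) i zero
  zero∈i*·i i with nonempty i
  ... | x , y , refl = intersection-pos {y} {x} {y} (transpose x y) refl (rel-refl y)

  i∈i·zero : ∀ i → 0 < p i zero i
  i∈i·zero i with nonempty i
  ... | x , y , refl = intersection-pos {x} {y} {y} refl (rel-refl y) refl

  valency-pos : ∀ i → 0 < val i
  valency-pos i with nonempty i
  ... | x , y , refl = intersection-pos {x} {y} {x} refl (transpose x y) (rel-refl x)

  count-neighbours : ∀ x i → count (λ z → ⌊ rel x z ≟ i ⌋) ≡ val i
  count-neighbours x i = trans (count-cong _ _ back-to-x) (regular i (i *) zero x x (rel-refl x))
    where
    back-to-x : ∀ z → ⌊ rel x z ≟ i ⌋ ≡ ⌊ rel x z ≟ i ⌋ ∧ ⌊ rel z x ≟ i * ⌋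
    back-to-x z with rel x z ≟ i
    ... | yes x→z = sym (to T-≡ (fromWitness (rel-transpose x→z)))
    ... | no  _   = refl

  neighbour : ∀ x i → ∃ λ z → rel x z ≡ i
  neighbour x i =
    let z , hit = count-witness _ (subst (0 <_) (sym (count-neighbours x i)) (valency-pos i))
    in  z , toWitness hit

  walk : Fin n → Idx → (Idx → Bool) → Fin n → Fin n → Bool
  walk x i P y z = ⌊ rel x z ≟ i ⌋ ∧ P (rel z y)

  ProductOf : (Idx → Bool) → Idx → Set
  ProductOf P k = ∃₂ λ a b → T (P a) × T (P b) × 0 < p (a *) b k

  productOf? : ∀ P → Decidable (ProductOf P)
  productOf? P k = any? λ a → any? λ b → T? (P a) ×-dec T? (P b) ×-dec 0 ℕₚ.<? p (a *) b k

  -- opaque, so that the type checker never unfolds the iterated closure `generated`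
  opaque
    close : (Idx → Bool) → Idx → Bool
    close P k = P k ∨ ⌊ productOf? P k ⌋

    close-extensive : ∀ P → P ⊆ᵇ close P
    close-extensive P k Pk = from (T-∨ {P k}) (inj₁ Pk)

    close-intro : ∀ P {k} → ProductOf P k → T (close P k)
    close-intro P {k} product = from (T-∨ {P k}) (inj₂ (fromWitness product))

    close-elim : ∀ P {k} → T (close P k) → T (P k) ⊎ ProductOf P k
    close-elim P {k} h = map₂ toWitness (to (T-∨ {P k}) h)

  close-mono : ∀ P Q → P ⊆ᵇ Q → close P ⊆ᵇ close Q
  close-mono P Q P⊆Q k h with close-elim P h
  ... | inj₁ Pk                        = close-extensive Q k (P⊆Q k Pk)
  ... | inj₂ (a , b , Pa , Pb , a*b∋k) = close-intro Q (a , b , P⊆Q a Pa , P⊆Q b Pb , a*b∋k)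

  open Saturation close close-mono close-extensive

  -- O_ϑ(S) together with the generators R_{j*}R_j of the thin residue O^ϑ(S)
  seed : Idx → Bool
  seed k = ⌊ val k ℕₚ.≟ 1 ⌋ ∨ ⌊ any? (λ j → 0 ℕₚ.<? p (j *) j k) ⌋

  Oθ⊆seed : ∀ {k} → Oθ k → T (seed k)
  Oθ⊆seed {k} θ = from (T-∨ {⌊ val k ℕₚ.≟ 1 ⌋}) (inj₁ (fromWitness θ))

  thin⊆seed : ∀ {j k} → 0 < p (j *) j k → T (seed k)
  thin⊆seed {j} {k} j*j∋k =
    from (T-∨ {⌊ val k ℕₚ.≟ 1 ⌋}) (inj₂ (fromWitness (j , j*j∋k)))

  seed-elim : ∀ {k} → T (seed k) → Oθ k ⊎ ∃ λ j → 0 < p (j *) j k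
  seed-elim {k} h = map toWitness toWitness (to (T-∨ {⌊ val k ℕₚ.≟ 1 ⌋}) h)

  -- |S| + 1 rounds of `close` reach a fixed point; U is kept Boolean to form ∑_{R_i ∈ U} A_i
  generated : Idx → Bool
  generated = fold seed close (suc (suc d))

  generated-closed : close generated ⊆ᵇ generated
  generated-closed = fold-stable seed

  Oθ⊆generated : ∀ {k} → Oθ k → T (generated k)
  Oθ⊆generated {k} θ = fold-extensive seed (suc (suc d)) k (Oθ⊆seed θ)

  thin⊆generated : ∀ {j k} → 0 < p (j *) j k → T (generated k)
  thin⊆generated {k = k} j*j∋k = fold-extensive seed (suc (suc d)) k (thin⊆seed j*j∋k)

  module Cosets (P : Idx → Bool) (P-closed : close P ⊆ᵇ P)
                (P-thin : ∀ {j k} → 0 < p (j *) j k → T (P k)) where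

    _∼_ : Fin n → Fin n → Set
    x ∼ y = T (P (rel x y))

    ∼-refl : ∀ x → x ∼ x
    ∼-refl x = subst (T ∘ P) (sym (rel-refl x)) (P-thin (zero∈i*·i zero))

    ∼-euclidean : ∀ {x y z} → z ∼ x → z ∼ y → x ∼ y
    ∼-euclidean {x} {y} {z} z∼x z∼y =
      P-closed _ (close-intro P (_ , _ , z∼x , z∼y , intersection-pos (transpose z x) refl refl))

    ∼-sym : ∀ {x y} → x ∼ y → y ∼ x
    ∼-sym {x} x∼y = ∼-euclidean x∼y (∼-refl x)

    ∼-trans : ∀ {x y z} → x ∼ z → z ∼ y → x ∼ y
    ∼-trans x∼z z∼y = ∼-euclidean (∼-sym x∼z) z∼y

    ∼-respects : ∀ {x z} y → x ∼ z → P (rel x y) ≡ P (rel z y)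
    ∼-respects y x∼z = T-ext (∼-trans (∼-sym x∼z)) (∼-trans x∼z)

    same-neighbourhood : ∀ {x z z′ i} → rel x z ≡ i → rel x z′ ≡ i → z ∼ z′
    same-neighbourhood x→z x→z′ = P-thin (intersection-pos (rel-transpose x→z) x→z′ refl)

    count-coset : ∀ x i y {z₀} → rel x z₀ ≡ i →
                  count (walk x i P y) ≡ (if P (rel z₀ y) then val i else 0)
    count-coset x i y {z₀} x→z₀ =
      trans (count-∧-constʳ (λ z → ⌊ rel x z ≟ i ⌋) (λ z → P (rel z y)) _ in-z₀-coset)
            (cong (λ c → if P (rel z₀ y) then c else 0) (count-neighbours x i))
      where
      in-z₀-coset : ∀ z → T ⌊ rel x z ≟ i ⌋ → P (rel z y) ≡ P (rel z₀ y)
      in-z₀-coset z x→z = ∼-respects y (same-neighbourhood (toWitness x→z) x→z₀)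

  All-stronglyNormal : StronglyNormalClosed All
  All-stronglyNormal = ((zero , tt) , λ _ → tt) , λ _ _ → tt

  module WithinStronglyNormal (C : SubS) (C-snc : StronglyNormalClosed C)
                              (Oθ⊆C : Oθ ⊆ C) where

    C-closed : ((C ᵀ) ·S C) ⊆ C
    C-closed = proj₂ (proj₁ C-snc)

    C-zero : C zero
    C-zero = let t , Ct = proj₁ (proj₁ C-snc)
             in  C-closed (t * , t , (t , Ct , refl) , Ct , zero∈i*·i t)

    C-thin : ∀ {j k} → 0 < p (j *) j k → C k
    C-thin {j} j*j∋k =
      proj₂ C-snc j (j * , j , (j * , zero , refl , C-zero , i∈i·zero (j *)) , refl , j*j∋k)

    seed⊆C : ∀ k → T (seed k) → C k
    seed⊆C k h with seed-elim h
    ... | inj₁ θ            = Oθ⊆C θ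
    ... | inj₂ (_ , j*j∋k) = C-thin j*j∋k

    fold⊆C : ∀ m k → T (fold seed close m k) → C k
    fold⊆C zero    = seed⊆C
    fold⊆C (suc m) k h with close-elim _ h
    ... | inj₁ earlier                   = fold⊆C m k earlier
    ... | inj₂ (a , b , Pa , Pb , a*b∋k) =
      C-closed (a * , b , (a , fold⊆C m a Pa , refl) , fold⊆C m b Pb , a*b∋k)

    generated⊆C : ∀ k → T (generated k) → C k
    generated⊆C = fold⊆C (suc (suc d))

module FieldFacts {c ℓ : Level} (F : Field c ℓ) where
  open Field F
    using (Carrier; _≈_; _*_; 0#; 1#; 1≉0; setoid; semiring; +-cong; *-cong; *-congˡ; *-congʳ;
           +-identityˡ; +-identityʳ; *-identityˡ; *-identityʳ; zeroˡ; zeroʳ)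
    renaming (refl to ≈-refl; sym to ≈-sym; trans to ≈-trans; reflexive to ≈-reflexive)
  open FieldOps F
  open SemiringMult semiring using (×1-homo-*) renaming (_×_ to _⨰_)
  open import Relation.Binary.Reasoning.Setoid setoid

  ℕ→F≈⨰1# : ∀ m → ℕ→F m ≈ m ⨰ 1#
  ℕ→F≈⨰1# zero    = ≈-refl
  ℕ→F≈⨰1# (suc m) = +-cong ≈-refl (ℕ→F≈⨰1# m)

  ℕ→F-* : ∀ m k → ℕ→F (m ℕ.* k) ≈ ℕ→F m * ℕ→F k
  ℕ→F-* m k = begin
    ℕ→F (m ℕ.* k)        ≈⟨ ℕ→F≈⨰1# (m ℕ.* k) ⟩
    (m ℕ.* k) ⨰ 1#       ≈⟨ ×1-homo-* m k ⟩
    (m ⨰ 1#) * (k ⨰ 1#)  ≈⟨ *-cong (ℕ→F≈⨰1# m) (ℕ→F≈⨰1# k) ⟨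
    ℕ→F m * ℕ→F k        ∎

  characteristic-∣⇒≈0 : ∀ {q m} → HasCharacteristic q → q ∣ m → ℕ→F m ≈ 0#
  characteristic-∣⇒≈0 {q} (_ , q≈0 , _) (divides k refl) = begin
    ℕ→F (k ℕ.* q)  ≈⟨ ℕ→F-* k q ⟩
    ℕ→F k * ℕ→F q  ≈⟨ *-congˡ q≈0 ⟩
    ℕ→F k * 0#     ≈⟨ zeroʳ _ ⟩
    0#             ∎

  annihilated : ∀ {a} u v → a ≈ 0# → a * u ≈ a * v
  annihilated u v a≈0 =
    ≈-trans (≈-trans (*-congʳ a≈0) (zeroˡ u)) (≈-sym (≈-trans (*-congʳ a≈0) (zeroˡ v)))

  ι : Bool → Carrier
  ι b = if b then 1# else 0#

  ι-∧ : ∀ a b → ι a * ι b ≈ ι (a ∧ b)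
  ι-∧ true  b = *-identityˡ (ι b)
  ι-∧ false b = zeroˡ (ι b)

  T⇒ι≈1 : ∀ {b} → T b → ι b ≈ 1#
  T⇒ι≈1 {true} _ = ≈-refl

  ι≈1⇒T : ∀ {b} → ι b ≈ 1# → T b
  ι≈1⇒T {true}  _   = tt
  ι≈1⇒T {false} 0≈1 = 1≉0 (≈-sym 0≈1)

  ι-no : ∀ {a} {A : Set a} (a? : Dec A) → ¬ A → ι ⌊ a? ⌋ ≈ 0#
  ι-no (yes a) ¬a = ⊥-elim (¬a a)
  ι-no (no _)  _  = ≈-refl

  ℕ→F-if : ∀ b m → ℕ→F (if b then m else 0) ≈ ℕ→F m * ι b
  ℕ→F-if true  m = ≈-sym (*-identityʳ _)
  ℕ→F-if false m = ≈-sym (zeroʳ _)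

  ΣF-cong : ∀ {m} {f g : Fin m → Carrier} → (∀ i → f i ≈ g i) → ΣF f ≈ ΣF g
  ΣF-cong {zero}  _   = ≈-refl
  ΣF-cong {suc m} f≈g = +-cong (f≈g zero) (ΣF-cong (f≈g ∘ suc))

  ΣF-zero : ∀ {m} (f : Fin m → Carrier) → (∀ i → f i ≈ 0#) → ΣF f ≈ 0#
  ΣF-zero {zero}  f _   = ≈-refl
  ΣF-zero {suc m} f f≈0 =
    ≈-trans (+-cong (f≈0 zero) (ΣF-zero (f ∘ suc) (f≈0 ∘ suc))) (+-identityˡ 0#)

  ΣF-single : ∀ {m} (f : Fin m → Carrier) r →
              (∀ i → ¬ i ≡ r → f i ≈ 0#) → ΣF f ≈ f r
  ΣF-single {suc m} f zero    off =
    ≈-trans (+-cong ≈-refl (ΣF-zero (f ∘ suc) (λ i → off (suc i) λ ())))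
            (+-identityʳ (f zero))
  ΣF-single {suc m} f (suc r) off =
    ≈-trans (+-cong (off zero λ ()) (ΣF-single (f ∘ suc) r off-suc)) (+-identityˡ _)
    where
    off-suc : ∀ i → ¬ i ≡ r → f (suc i) ≈ 0#
    off-suc i i≢r = off (suc i) (i≢r ∘ suc-injective)

  ΣF-indicator : ∀ {m} (b : Fin m → Bool) → ΣF (ι ∘ b) ≈ ℕ→F (count b)
  ΣF-indicator {zero}  b = ≈-refl
  ΣF-indicator {suc m} b with b zero
  ... | true  = +-cong ≈-refl (ΣF-indicator (b ∘ suc))
  ... | false = ≈-trans (+-identityˡ _) (ΣF-indicator (b ∘ suc))

  module Spans {n d : ℕ} (S : AssociationScheme n d) where
    open SchemeNotions S
    open SchemeFacts S
    open OverField F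

    span : (Idx → Bool) → Mat n
    span P x y = ΣF (λ i → ι (P i) * Adj i x y)

    span-entry : ∀ P x y → span P x y ≈ ι (P (rel x y))
    span-entry P x y = begin
      span P x y
        ≈⟨ ΣF-single (λ i → ι (P i) * Adj i x y) (rel x y) off-diagonal ⟩
      ι (P (rel x y)) * Adj (rel x y) x y
        ≈⟨ *-congˡ (T⇒ι≈1 (fromWitness {a? = rel x y ≟ rel x y} refl)) ⟩
      ι (P (rel x y)) * 1#
        ≈⟨ *-identityʳ _ ⟩
      ι (P (rel x y))
        ∎
      where
      off-diagonal : ∀ i → ¬ i ≡ rel x y → ι (P i) * Adj i x y ≈ 0#
      off-diagonal i i≢rel = ≈-trans (*-congˡ (ι-no (rel x y ≟ i) (i≢rel ∘ sym))) (zeroʳ _)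

    Adj·span : ∀ P i x y → (Adj i ·M span P) x y ≈ ℕ→F (count (walk x i P y))
    Adj·span P i x y = begin
      ΣF (λ z → Adj i x z * span P z y)
        ≈⟨ ΣF-cong (λ z → *-congˡ (span-entry P z y)) ⟩
      ΣF (λ z → ι ⌊ rel x z ≟ i ⌋ * ι (P (rel z y)))
        ≈⟨ ΣF-cong (λ z → ι-∧ ⌊ rel x z ≟ i ⌋ (P (rel z y))) ⟩
      ΣF (ι ∘ walk x i P y)
        ≈⟨ ΣF-indicator (walk x i P y) ⟩
      ℕ→F (count (walk x i P y))
        ∎

    span-trivial : ∀ P → T (P zero) →
      (∀ i x y → ℕ→F (count (walk x i P y)) ≈ ℕ→F (val i) * ι (P (rel x y))) →
      TrivialGen (span P)
    span-trivial P P₀ eigen = (ι ∘ P , λ x y → ≈-refl) , nonzero , eigenvector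
      where
      nonzero : ¬ (span P ≈M 0M)
      nonzero span≈0 with nonempty zero
      ... | x , _ = 1≉0 (begin
        1#              ≈⟨ T⇒ι≈1 P₀ ⟨
        ι (P zero)      ≡⟨ cong (ι ∘ P) (rel-refl x) ⟨
        ι (P (rel x x)) ≈⟨ span-entry P x x ⟨
        span P x x      ≈⟨ span≈0 x x ⟩
        0#              ∎)

      eigenvector : ∀ i → (Adj i ·M span P) ≈M (ℕ→F (val i) ⋆M span P)
      eigenvector i x y = begin
        (Adj i ·M span P) x y                              ≈⟨ Adj·span P i x y ⟩
        ℕ→F (count (walk x i P y)) ≈⟨ eigen i x y ⟩
        ℕ→F (val i) * ι (P (rel x y))                      ≈⟨ *-congˡ (span-entry P x y) ⟨
        ℕ→F (val i) * span P x y                           ∎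

    span-all-trivial : TrivialGen (span (λ _ → true))
    span-all-trivial = span-trivial _ tt λ i x y → begin
      ℕ→F (count (walk x i (λ _ → true) y))
        ≡⟨ cong ℕ→F (count-cong _ _ (λ z → ∧-identityʳ ⌊ rel x z ≟ i ⌋)) ⟩
      ℕ→F (count (λ z → ⌊ rel x z ≟ i ⌋))
        ≡⟨ cong ℕ→F (count-neighbours x i) ⟩
      ℕ→F (val i)
        ≈⟨ *-identityʳ _ ⟨
      ℕ→F (val i) * 1#
        ∎

    p-transitive⇒trivial-span-full : PTransitive → ∀ P → TrivialGen (span P) → T (P zero) →
                                     ∀ k → T (P k)
    p-transitive⇒trivial-span-full (_ , _ , unique) P trivial P₀ k
      with nonempty k | unique (span P) trivial | unique (span (λ _ → true)) span-all-trivial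
    ... | x , y , refl | (a , P≈a·v) , _ | _ , (b , v≈b·J) = ι≈1⇒T (begin
      ι (P (rel x y)) ≈⟨ span-entry P x y ⟨
      span P x y      ≈⟨ constant x y ⟩
      a * (b * 1#)    ≈⟨ constant x x ⟨
      span P x x      ≈⟨ span-entry P x x ⟩
      ι (P (rel x x)) ≡⟨ cong (ι ∘ P) (rel-refl x) ⟩
      ι (P zero)      ≈⟨ T⇒ι≈1 P₀ ⟩
      1#              ∎)
      where
      -- uniqueness of the trivial submodule makes span P a multiple of the all-one matrix J
      constant : ∀ x y → span P x y ≈ a * (b * 1#)
      constant x y =
        ≈-trans (P≈a·v x y)
                (*-congˡ (≈-trans (v≈b·J x y) (*-congˡ (span-entry (λ _ → true) x y))))

    generated-trivial : ∀ {q} → HasCharacteristic q → (∀ i → ¬ Oθ i → q ∣ val i) →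
                        TrivialGen (span generated)
    generated-trivial char q∣val = span-trivial generated (thin⊆generated (zero∈i*·i zero)) eigen
      where
      open Cosets generated generated-closed thin⊆generated

      eigen : ∀ i x y → ℕ→F (count (walk x i generated y)) ≈
                        ℕ→F (val i) * ι (generated (rel x y))
      eigen i x y with neighbour x i
      ... | z₀ , x→z₀ = begin
        ℕ→F (count (walk x i generated y))
          ≡⟨ cong ℕ→F (count-coset x i y x→z₀) ⟩
        ℕ→F (if generated (rel z₀ y) then val i else 0)
          ≈⟨ ℕ→F-if (generated (rel z₀ y)) (val i) ⟩
        ℕ→F (val i) * ι (generated (rel z₀ y))
          ≈⟨ coset-of-x ⟩
        ℕ→F (val i) * ι (generated (rel x y))
          ∎
        where
        coset-of-x : ℕ→F (val i) * ι (generated (rel z₀ y)) ≈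
                     ℕ→F (val i) * ι (generated (rel x y))
        coset-of-x with T? (generated i)
        ... | yes i∈U = ≈-reflexive (cong (λ b → ℕ→F (val i) * ι b)
                          (sym (∼-respects y (subst (T ∘ generated) (sym x→z₀) i∈U))))
        ... | no  i∉U =
          annihilated _ _ (characteristic-∣⇒≈0 char (q∣val i (i∉U ∘ Oθ⊆generated)))

corollary3p10 : {c ℓ : Level} (F : Field c ℓ) (p : ℕ) →
    FieldOps.HasCharacteristic F p →
    {n d : ℕ} (S : AssociationScheme n d) →
    (∀ i → ¬ SchemeNotions.Oθ S i → p ∣ SchemeNotions.val S i) →
    SchemeNotions.OverField.PTransitive S F →
    SchemeNotions.UniqueSNContainingOθ S
corollary3p10 F p char S p∣val p-transitive =
  (All-stronglyNormal , λ _ → tt) ,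
  λ C C-snc Oθ⊆C {k} _ → WithinStronglyNormal.generated⊆C C C-snc Oθ⊆C k (generated-full k)
  where
  open SchemeFacts S
  open FieldFacts.Spans F S

  generated-full : ∀ k → T (generated k)
  generated-full = p-transitive⇒trivial-span-full p-transitive generated
                     (generated-trivial char p∣val) (thin⊆generated (zero∈i*·i zero))
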